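{- For each of the fourteen pairs $(\mathsf{G1CL},\mathsf{CL})$ described in the context and every formula $A$, the sequent $\Rightarrow A$ is derivable in $\mathsf{G1CL}$ if and only if $A$ is derivable in $\mathsf{CL}$.
   Context: Formulas: $A ::= p \mid \bot \mid A\wedge A \mid A\vee A \mid A\to A \mid \Box A \mid \Diamond A$; $\top:=\bot\to\bot$. $\mathsf{MPL}$: axioms $A\wedge B\to A$, $A\wedge B\to B$, $A\to A\vee B$, $B\to A\vee B$, $(A\to B)\to((A\to C)\to(A\to B\wedge C))$, $(A\to C)\to((B\to C)\to(A\vee B\to C))$, $(A\to(B\to C))\to((A\to B)\to(A\to C))$, $A\to(B\to A)$, modus ponens. Axiomatic modal principles: Mon$\Box$: rule $A\to B/\Box A\to\Box B$; Mon$\Diamond$: rule $A\to B/\Diamond A\to\Diamond B$; N$\Box$: $\Box\top$; C$\Box$: $\Box A\wedge\Box B\to\Box(A\wedge B)$; K$\Diamond$: $\Box(A\to B)\to(\Diamond A\to\Diamond B)$; P$\Diamond$: $\Diamond\top$; D: $\Box A\to\Diamond A$; T$\Box$: $\Box A\to A$; T$\Diamond$: $A\to\Diamond A$. Minimal logics: $\mathsf{MM}=\mathsf{MPL}$+Mon$\Box$+Mon$\Diamond$; $\mathsf{MMP}=\mathsf{MM}$+P$\Diamond$; $\mathsf{MMN}=\mathsf{MM}$+N$\Box$; $\mathsf{MMNP}=\mathsf{MMN}$+P$\Diamond$; $\mathsf{MMC}=\mathsf{MM}$+C$\Box$+K$\Diamond$; $\mathsf{MK}=\mathsf{MMC}$+N$\Box$;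 $\mathsf{MMD}=\mathsf{MM}$+D+P$\Diamond$; $\mathsf{MMT}=\mathsf{MM}$+T$\Box$+T$\Diamond$; $\mathsf{MMND}=\mathsf{MMN}$+D; $\mathsf{MMNT}=\mathsf{MMN}$+T$\Box$+T$\Diamond$; $\mathsf{MMCD}=\mathsf{MMC}$+D+P$\Diamond$; $\mathsf{MMCT}=\mathsf{MMC}$+T$\Box$+T$\Diamond$; $\mathsf{MKD}=\mathsf{MK}$+D; $\mathsf{MKT}=\mathsf{MK}$+T$\Box$+T$\Diamond$. For each minimal logic $\mathsf{MX}$, the constructive logic $\mathsf{CX}$ is $\mathsf{MX}+(\bot\to A)$. Sequents $\Gamma\Rightarrow\delta$ ($\Gamma$ finite multiset, $\delta$ empty or one formula); $\Box\Sigma$ prefixes $\Box$ to each member of $\Sigma$; derivations are finite trees. $\mathsf{G1IPL}$: initial sequents $A\Rightarrow A$ and $\bot\Rightarrow$; (L$\wedge$) $\Gamma,A_i\Rightarrow\delta$ / $\Gamma,A_1\wedge A_2\Rightarrow\delta$; (R$\wedge$) $\Gamma\Rightarrow A$, $\Gamma\Rightarrow B$ / $\Gamma\Rightarrow A\wedge B$; (L$\vee$) $\Gamma,A\Rightarrow\delta$, $\Gamma,B\Rightarrow\delta$ / $\Gamma,A\vee B\Rightarrow\delta$; (R$\vee$) $\Gamma\Rightarrow A_i$ / $\Gamma\Rightarrow A_1\vee A_2$; (R$\to$) $\Gamma,A\Rightarrow B$ / $\Gamma\Rightarrow A\to B$; (L$\to$) $\Gamma\Rightarrow A$, $\Gamma,B\Rightarrow\delta$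 / $\Gamma,A\to B\Rightarrow\delta$; (LW) $\Gamma\Rightarrow\delta$ / $\Gamma,A\Rightarrow\delta$; (RW) $\Gamma\Rightarrow$ / $\Gamma\Rightarrow A$; (LC) $\Gamma,A,A\Rightarrow\delta$ / $\Gamma,A\Rightarrow\delta$. Sequent modal rules: (M$\Box$) $A\Rightarrow B$ / $\Box A\Rightarrow\Box B$; (M$\Diamond$) $A\Rightarrow B$ / $\Diamond A\Rightarrow\Diamond B$; (N$\Box$) $\Rightarrow A$ / $\Rightarrow\Box A$; (C$\Box$) $\Sigma,A\Rightarrow B$ / $\Box\Sigma,\Box A\Rightarrow\Box B$; (K$\Box$) $\Sigma\Rightarrow A$ / $\Box\Sigma\Rightarrow\Box A$; (K$\Diamond$) $\Sigma,A\Rightarrow B$ / $\Box\Sigma,\Diamond A\Rightarrow\Diamond B$; (P$\Diamond$) $\Rightarrow A$ / $\Rightarrow\Diamond A$; (D) $A\Rightarrow B$ / $\Box A\Rightarrow\Diamond B$; (CD) $\Sigma\Rightarrow A$ / $\Box\Sigma\Rightarrow\Diamond A$; (iT$\Box$) $\Gamma,A\Rightarrow\delta$ / $\Gamma,\Box A\Rightarrow\delta$; (T$\Diamond$) $\Gamma\Rightarrow A$ / $\Gamma\Rightarrow\Diamond A$. Calculi ($\mathsf{G1IPL}$ plus): $\mathsf{G1CM}$: M$\Box$,M$\Diamond$; $\mathsf{G1CMP}$: $\mathsf{G1CM}$+P$\Diamond$; $\mathsf{G1CMN}$: $\mathsf{G1CM}$+N$\Box$; $\mathsf{G1CMNP}$: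 $\mathsf{G1CMN}$+P$\Diamond$; $\mathsf{G1CMC}$: C$\Box$,K$\Diamond$; $\mathsf{G1CK}$: K$\Box$,K$\Diamond$; $\mathsf{G1CMD}$: $\mathsf{G1CM}$+D+P$\Diamond$; $\mathsf{G1CMT}$: $\mathsf{G1CM}$+iT$\Box$+T$\Diamond$; $\mathsf{G1CMND}$: $\mathsf{G1CMN}$+D+P$\Diamond$; $\mathsf{G1CMNT}$: $\mathsf{G1CMN}$+iT$\Box$+T$\Diamond$; $\mathsf{G1CMCD}$: $\mathsf{G1CMC}$+CD; $\mathsf{G1CMCT}$: $\mathsf{G1CMC}$+iT$\Box$+T$\Diamond$; $\mathsf{G1CKD}$: $\mathsf{G1CK}$+CD; $\mathsf{G1CKT}$: $\mathsf{G1CK}$+iT$\Box$+T$\Diamond$. Pairs: $\mathsf{G1CX}$ with $\mathsf{CX}$ where $\mathsf{CX}=\mathsf{MX}+(\bot\to A)$ (e.g. $\mathsf{G1CMNT}$ with $\mathsf{MMNT}+(\bot\to A)$, $\mathsf{G1CK}$ with $\mathsf{MK}+(\bot\to A)$). -}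

module Defs where

open import Data.Nat using (ℕ)
open import Data.Bool using (Bool; true; false; T)
open import Data.List using (List; []; _∷_; map; [_])
open import Data.Maybe using (Maybe; just; nothing)
open import Data.List.Relation.Binary.Permutation.Propositional using (_↭_)

infixr 8 _∧_
infixr 7 _∨_
infixr 6 _⊃_
infix 9 □_ ◇_
data Fm : Set where
  var  : ℕ → Fm
  ⊥f   : Fm
  _∧_  : Fm → Fm → Fm
  _∨_  : Fm → Fm → Fm
  _⊃_  : Fm → Fm → Fm
  □_   : Fm → Fm
  ◇_   : Fm → Fm

⊤f : Fm
⊤f = ⊥f ⊃ ⊥f

data Logic : Set where
  M MP MN MNP MC K MD MT MND MNT MCD MCT KD KT : Logic

-- Hilbert-style systems  MX ; CX = MX + (⊥ → A)
-- Every logic contains MM = MPL + Mon□ + Mon◇.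

hP : Logic → Bool
hP MP = true
hP MNP = true
hP MD = true
hP MCD = true
hP _ = false

hN : Logic → Bool
hN MN = true
hN MNP = true
hN K = true
hN MND = true
hN MNT = true
hN KD = true
hN KT = true
hN _ = false

hC : Logic → Bool
hC MC = true
hC K = true
hC MCD = true
hC MCT = true
hC KD = true
hC KT = true
hC _ = false

hD : Logic → Bool
hD MD = true
hD MND = true
hD MCD = true
hD KD = true
hD _ = false

hT : Logic → Bool
hT MT = true
hT MNT = true
hT MCT = true
hT KT = true
hT _ = false

data CX (L : Logic) : Fm → Set where
  ax1  : ∀ A B → CX L (A ∧ B ⊃ A)
  ax2  : ∀ A B → CX L (A ∧ B ⊃ B)
  ax3  : ∀ A B → CX L (A ⊃ A ∨ B)
  ax4  : ∀ A B → CX L (B ⊃ A ∨ B)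
  ax5  : ∀ A B C → CX L ((A ⊃ B) ⊃ ((A ⊃ C) ⊃ (A ⊃ B ∧ C)))
  ax6  : ∀ A B C → CX L ((A ⊃ C) ⊃ ((B ⊃ C) ⊃ (A ∨ B ⊃ C)))
  ax7  : ∀ A B C → CX L ((A ⊃ (B ⊃ C)) ⊃ ((A ⊃ B) ⊃ (A ⊃ C)))
  ax8  : ∀ A B → CX L (A ⊃ (B ⊃ A))
  efq  : ∀ A → CX L (⊥f ⊃ A)
  mp   : ∀ {A B} → CX L (A ⊃ B) → CX L A → CX L B
  monB : ∀ {A B} → CX L (A ⊃ B) → CX L (□ A ⊃ □ B)
  monD : ∀ {A B} → CX L (A ⊃ B) → CX L (◇ A ⊃ ◇ B)
  axPD : T (hP L) → CX L (◇ ⊤f)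
  axNB : T (hN L) → CX L (□ ⊤f)
  axCB : T (hC L) → ∀ A B → CX L (□ A ∧ □ B ⊃ □ (A ∧ B))
  axKD : T (hC L) → ∀ A B → CX L (□ (A ⊃ B) ⊃ (◇ A ⊃ ◇ B))
  axD  : T (hD L) → ∀ A → CX L (□ A ⊃ ◇ A)
  axTB : T (hT L) → ∀ A → CX L (□ A ⊃ A)
  axTD : T (hT L) → ∀ A → CX L (A ⊃ ◇ A)

-- Sequent calculi G1CX.  Antecedents are multisets, represented as lists
-- closed under permutation (rule perm); succedent is empty or one formula.

sM : Logic → Bool
sM M = true
sM MP = true
sM MN = true
sM MNP = true
sM MD = true
sM MT = true
sM MND = true
sM MNT = true
sM _ = false

sP : Logic → Bool
sP MP = true
sP MNP = true
sP MD = true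
sP MND = true
sP _ = false

sN : Logic → Bool
sN MN = true
sN MNP = true
sN MND = true
sN MNT = true
sN _ = false

sC : Logic → Bool
sC MC = true
sC MCD = true
sC MCT = true
sC _ = false

sK : Logic → Bool
sK K = true
sK KD = true
sK KT = true
sK _ = false

sKD : Logic → Bool
sKD MC = true
sKD MCD = true
sKD MCT = true
sKD K = true
sKD KD = true
sKD KT = true
sKD _ = false

sD : Logic → Bool
sD MD = true
sD MND = true
sD _ = false

sCD : Logic → Bool
sCD MCD = true
sCD KD = true
sCD _ = false

sT : Logic → Bool
sT MT = true
sT MNT = true
sT MCT = true
sT KT = true
sT _ = false

infix 2 G1
data G1 (L : Logic) : List Fm → Maybe Fm → Set where
  perm : ∀ {Γ Δ δ} → Γ ↭ Δ → G1 L Γ δ → G1 L Δ δ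
  idA  : ∀ A → G1 L [ A ] (just A)
  botL : G1 L [ ⊥f ] nothing
  L∧₁  : ∀ {Γ A B δ} → G1 L (A ∷ Γ) δ → G1 L (A ∧ B ∷ Γ) δ
  L∧₂  : ∀ {Γ A B δ} → G1 L (B ∷ Γ) δ → G1 L (A ∧ B ∷ Γ) δ
  R∧   : ∀ {Γ A B} → G1 L Γ (just A) → G1 L Γ (just B) → G1 L Γ (just (A ∧ B))
  L∨   : ∀ {Γ A B δ} → G1 L (A ∷ Γ) δ → G1 L (B ∷ Γ) δ → G1 L (A ∨ B ∷ Γ) δ
  R∨₁  : ∀ {Γ A B} → G1 L Γ (just A) → G1 L Γ (just (A ∨ B))
  R∨₂  : ∀ {Γ A B} → G1 L Γ (just B) → G1 L Γ (just (A ∨ B))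
  R⊃   : ∀ {Γ A B} → G1 L (A ∷ Γ) (just B) → G1 L Γ (just (A ⊃ B))
  L⊃   : ∀ {Γ A B δ} → G1 L Γ (just A) → G1 L (B ∷ Γ) δ → G1 L (A ⊃ B ∷ Γ) δ
  LW   : ∀ {Γ A δ} → G1 L Γ δ → G1 L (A ∷ Γ) δ
  RW   : ∀ {Γ A} → G1 L Γ nothing → G1 L Γ (just A)
  LC   : ∀ {Γ A δ} → G1 L (A ∷ A ∷ Γ) δ → G1 L (A ∷ Γ) δ
  M□   : T (sM L) → ∀ {A B} → G1 L [ A ] (just B) → G1 L [ □ A ] (just (□ B))
  M◇   : T (sM L) → ∀ {A B} → G1 L [ A ] (just B) → G1 L [ ◇ A ] (just (◇ B))
  N□   : T (sN L) → ∀ {A} → G1 L [] (just A) → G1 L [] (just (□ A))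
  C□   : T (sC L) → ∀ {Σ A B} → G1 L (A ∷ Σ) (just B)
         → G1 L (□ A ∷ map □_ Σ) (just (□ B))
  K□   : T (sK L) → ∀ {Σ A} → G1 L Σ (just A) → G1 L (map □_ Σ) (just (□ A))
  K◇   : T (sKD L) → ∀ {Σ A B} → G1 L (A ∷ Σ) (just B)
         → G1 L (◇ A ∷ map □_ Σ) (just (◇ B))
  P◇   : T (sP L) → ∀ {A} → G1 L [] (just A) → G1 L [] (just (◇ A))
  Dr   : T (sD L) → ∀ {A B} → G1 L [ A ] (just B) → G1 L [ □ A ] (just (◇ B))
  CDr  : T (sCD L) → ∀ {Σ A} → G1 L Σ (just A) → G1 L (map □_ Σ) (just (◇ A))
  iT□  : T (sT L) → ∀ {Γ A δ} → G1 L (A ∷ Γ) δ → G1 L (□ A ∷ Γ) δ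
  T◇   : T (sT L) → ∀ {Γ A} → G1 L Γ (just A) → G1 L Γ (just (◇ A))

module Submission where

-- Since G1 has no cut rule, modus ponens cannot be translated directly. We go
-- through a G3-style variant of each calculus (principal formulas located by
-- membership, contexts kept in the premises, so weakening and contraction are
-- built in), which embeds into G1. Cut is admissible there by induction on the
-- cut formula and then on the two derivations; the delicate modal cases are
-- those where the cut formula is among the boxed context formulas of C□, K□, CD
-- or K◇, handled by splitting that context. Conversely every G1 rule is sound
-- for CX; for C□, K□ and K◇ the boxed context is folded into one conjunction
-- and the axiom C□ is applied.

open import Defs
open import Data.Bool using (Bool; T) renaming (_∧_ to _&&_; _∨_ to _||_)
open import Data.Bool.Properties using (T-∧; T-∨)
open import Data.Empty using (⊥; ⊥-elim)
open import Data.List using (List; []; _∷_; [_]; _++_; map)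
open import Data.List.Membership.Propositional using (_∈_)
open import Data.List.Membership.Propositional.Properties using (∈-∃++; ∈-++⁺ʳ)
open import Data.List.Relation.Binary.Permutation.Propositional using (↭-refl; ↭-prep; ↭-swap; ↭-sym)
open import Data.List.Relation.Binary.Permutation.Propositional.Properties using (++-comm; shift)
open import Data.List.Relation.Binary.Subset.Propositional using (_⊆_)
open import Data.List.Relation.Binary.Subset.Propositional.Properties using (⊆-refl; ⊆-trans; ⊆-reflexive-↭; ∷⁺ʳ; ∈-∷⁺ʳ; xs⊆xs++ys; xs⊆ys++xs)
open import Data.List.Relation.Unary.All as All using (All; []; _∷_)
open import Data.List.Relation.Unary.All.Properties using (++⁺)
open import Data.List.Relation.Unary.Any using (here; there)
open import Data.Maybe using (just; fromMaybe)
open import Data.Product using (_,_)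
open import Data.Sum using (_⊎_; inj₁; inj₂)
open import Relation.Nullary.Decidable using (True; toWitness; ¬?; _×-dec_; _→-dec_; T?)
open import Relation.Unary using (Decidable)
open import Function.Bundles using (_⇔_; mk⇔; Equivalence)
open import Relation.Binary.PropositionalEquality using (refl)

variable
  A B C P X : Fm
  Γ Γ₁ Δ S S′ : List Fm

logics : List Logic
logics = M ∷ MP ∷ MN ∷ MNP ∷ MC ∷ K ∷ MD ∷ MT ∷ MND ∷ MNT ∷ MCD ∷ MCT ∷ KD ∷ KT ∷ []

∈-logics : ∀ L → L ∈ logics
∈-logics M   = here refl
∈-logics MP  = there (here refl)
∈-logics MN  = there (there (here refl))
∈-logics MNP = there (there (there (here refl)))
∈-logics MC  = there (there (there (there (here refl))))
∈-logics K   = there (there (there (there (there (here refl)))))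
∈-logics MD  = there (there (there (there (there (there (here refl))))))
∈-logics MT  = there (there (there (there (there (there (there (here refl)))))))
∈-logics MND = there (there (there (there (there (there (there (there (here refl))))))))
∈-logics MNT = there (there (there (there (there (there (there (there (there (here refl)))))))))
∈-logics MCD = there (there (there (there (there (there (there (there (there (there (here refl))))))))))
∈-logics MCT = there (there (there (there (there (there (there (there (there (there (there (here refl)))))))))))
∈-logics KD  = there (there (there (there (there (there (there (there (there (there (there (there (here refl))))))))))))
∈-logics KT  = there (there (there (there (there (there (there (there (there (there (there (there (there (here refl)))))))))))))

decideForAll : {P : Logic → Set} (P? : Decidable P) {_ : True (All.all? P? logics)}
             → ∀ L → P L
decideForAll P? {h} L = All.lookup (toWitness h) (∈-logics L)

implies : ∀ (p q : Logic → Bool)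
          {_ : True (All.all? (λ L → T? (p L) →-dec T? (q L)) logics)} {L}
        → T (p L) → T (q L)
implies p q {h} {L} = decideForAll (λ L → T? (p L) →-dec T? (q L)) {h} L

exclusive : ∀ (p q : Logic → Bool)
            {_ : True (All.all? (λ L → ¬? (T? (p L) ×-dec T? (q L))) logics)} {L}
          → T (p L) → T (q L) → ⊥
exclusive p q {h} {L} x y = decideForAll (λ L → ¬? (T? (p L) ×-dec T? (q L))) {h} L (x , y)

T-∨⁻ : ∀ {a b} → T (a || b) → T a ⊎ T b
T-∨⁻ = Equivalence.to T-∨

infix 4 □[_]⊆_
□[_]⊆_ : List Fm → List Fm → Set
□[ S ]⊆ Γ = All (λ A → □ A ∈ Γ) S

under : Δ ⊆ X ∷ Γ → A ∷ Δ ⊆ X ∷ A ∷ Γ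
under {X = X} {A = A} ρ = ⊆-trans (∷⁺ʳ A ρ) (⊆-reflexive-↭ (↭-swap A X ↭-refl))

#0 : A ∈ A ∷ Γ
#0 = here refl

#1 : A ∈ B ∷ A ∷ Γ
#1 = there #0

#2 : A ∈ B ∷ C ∷ A ∷ Γ
#2 = there #1

#3 : A ∈ B ∷ C ∷ P ∷ A ∷ Γ
#3 = there #2

swap⊆ : A ∷ B ∷ Γ ⊆ B ∷ A ∷ Γ
swap⊆ = under ⊆-refl

□⊆⇒map⊆ : □[ S ]⊆ Γ → map □_ S ⊆ Γ
□⊆⇒map⊆ (m ∷ b) (here refl) = m
□⊆⇒map⊆ (m ∷ b) (there n)   = □⊆⇒map⊆ b n

data BoxSplit (Γ : List Fm) : Fm → List Fm → Set where
  withCut    : □[ S′ ]⊆ Γ → S ⊆ A ∷ S′ → BoxSplit Γ (□ A) S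
  withoutCut : □[ S ]⊆ Γ → BoxSplit Γ X S

boxSplit : □[ S ]⊆ X ∷ Γ → BoxSplit Γ X S
boxSplit [] = withoutCut []
boxSplit (here refl ∷ b) with boxSplit b
... | withCut b′ inc = withCut b′ (∈-∷⁺ʳ #0 inc)
... | withoutCut b′  = withCut b′ ⊆-refl
boxSplit {S = A ∷ _} (there m ∷ b) with boxSplit b
... | withCut {A = Y} b′ inc = withCut (m ∷ b′) (∈-∷⁺ʳ #1 (⊆-trans inc (∷⁺ʳ Y there)))
... | withoutCut b′           = withoutCut (m ∷ b′)

-- A G3-style calculus with admissible cut

module G3 (L : Logic) where

  infix 3 _⊢_
  data _⊢_ : List Fm → Fm → Set where
    ax  : A ∈ Γ → Γ ⊢ A
    ⊥L  : ⊥f ∈ Γ → Γ ⊢ C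
    ∧L  : A ∧ B ∈ Γ → A ∷ B ∷ Γ ⊢ C → Γ ⊢ C
    ∧R  : Γ ⊢ A → Γ ⊢ B → Γ ⊢ A ∧ B
    ∨L  : A ∨ B ∈ Γ → A ∷ Γ ⊢ C → B ∷ Γ ⊢ C → Γ ⊢ C
    ∨R₁ : Γ ⊢ A → Γ ⊢ A ∨ B
    ∨R₂ : Γ ⊢ B → Γ ⊢ A ∨ B
    ⊃R  : A ∷ Γ ⊢ B → Γ ⊢ A ⊃ B
    ⊃L  : A ⊃ B ∈ Γ → Γ ⊢ A → B ∷ Γ ⊢ C → Γ ⊢ C
    T□L : T (sT L) → □ A ∈ Γ → A ∷ Γ ⊢ C → Γ ⊢ C
    M□  : T (sM L) → □ A ∈ Γ → [ A ] ⊢ B → Γ ⊢ □ B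
    M◇  : T (sM L) → ◇ A ∈ Γ → [ A ] ⊢ B → Γ ⊢ ◇ B
    N□  : T (sN L) → [] ⊢ A → Γ ⊢ □ A
    C□  : T (sC L) → □ A ∈ Γ → □[ S ]⊆ Γ → A ∷ S ⊢ B → Γ ⊢ □ B
    K□  : T (sK L) → □[ S ]⊆ Γ → S ⊢ A → Γ ⊢ □ A
    K◇  : T (sKD L) → ◇ A ∈ Γ → □[ S ]⊆ Γ → A ∷ S ⊢ B → Γ ⊢ ◇ B
    P◇  : T (sP L) → [] ⊢ A → Γ ⊢ ◇ A
    D   : T (sD L) → □ A ∈ Γ → [ A ] ⊢ B → Γ ⊢ ◇ B
    CD  : T (sCD L) → □[ S ]⊆ Γ → S ⊢ A → Γ ⊢ ◇ A
    T◇  : T (sT L) → Γ ⊢ A → Γ ⊢ ◇ A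

  rename : Γ ⊆ Δ → Γ ⊢ C → Δ ⊢ C
  rename σ (ax m)          = ax (σ m)
  rename σ (⊥L m)          = ⊥L (σ m)
  rename σ (∧L m d)        = ∧L (σ m) (rename (∷⁺ʳ _ (∷⁺ʳ _ σ)) d)
  rename σ (∧R d e)        = ∧R (rename σ d) (rename σ e)
  rename σ (∨L m d e)      = ∨L (σ m) (rename (∷⁺ʳ _ σ) d) (rename (∷⁺ʳ _ σ) e)
  rename σ (∨R₁ d)         = ∨R₁ (rename σ d)
  rename σ (∨R₂ d)         = ∨R₂ (rename σ d)
  rename σ (⊃R d)          = ⊃R (rename (∷⁺ʳ _ σ) d)
  rename σ (⊃L m d e)      = ⊃L (σ m) (rename σ d) (rename (∷⁺ʳ _ σ) e)
  rename σ (T□L t m d)     = T□L t (σ m) (rename (∷⁺ʳ _ σ) d)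
  rename σ (M□ t m d)      = M□ t (σ m) d
  rename σ (M◇ t m d)      = M◇ t (σ m) d
  rename σ (N□ t d)        = N□ t d
  rename σ (C□ t m b d)    = C□ t (σ m) (All.map σ b) d
  rename σ (K□ t b d)      = K□ t (All.map σ b) d
  rename σ (K◇ t m b d)    = K◇ t (σ m) (All.map σ b) d
  rename σ (P◇ t d)        = P◇ t d
  rename σ (D t m d)       = D t (σ m) d
  rename σ (CD t b d)      = CD t (All.map σ b) d
  rename σ (T◇ t d)        = T◇ t (rename σ d)

  T□L* : T (sT L) → □[ S ]⊆ Γ → S ++ Γ ⊢ C → Γ ⊢ C
  T□L* t [] d = d
  T□L* {S = A ∷ S} {Γ = Γ} t (m ∷ b) d =
    T□L t m (T□L* t (All.map there b) (rename (⊆-reflexive-↭ (↭-sym (shift A S Γ))) d))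

  -- Use Γ X C collects the premises of a rule concluding Γ ⊢ C in which X is
  -- principal on the left, with X itself removed from the antecedent.
  data Use (Γ : List Fm) : Fm → Fm → Set where
    ⊥-use   : Use Γ ⊥f C
    ∧-use   : A ∷ B ∷ Γ ⊢ C → Use Γ (A ∧ B) C
    ∨-use   : A ∷ Γ ⊢ C → B ∷ Γ ⊢ C → Use Γ (A ∨ B) C
    ⊃-use   : Γ ⊢ A → B ∷ Γ ⊢ C → Use Γ (A ⊃ B) C
    T□-use  : T (sT L) → A ∷ Γ ⊢ C → Use Γ (□ A) C
    M□-use  : T (sM L) → [ A ] ⊢ B → Use Γ (□ A) (□ B)
    D-use   : T (sD L) → [ A ] ⊢ B → Use Γ (□ A) (◇ B)
    C□-use  : T (sC L) → □[ S ]⊆ Γ → A ∷ S ⊢ B → Use Γ (□ A) (□ B)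
    K□-use  : T (sK L) → □[ S ]⊆ Γ → A ∷ S ⊢ B → Use Γ (□ A) (□ B)
    CD-use  : T (sCD L) → □[ S ]⊆ Γ → A ∷ S ⊢ B → Use Γ (□ A) (◇ B)
    K◇□-use : T (sKD L) → ◇ P ∈ Γ → □[ S ]⊆ Γ → P ∷ A ∷ S ⊢ B → Use Γ (□ A) (◇ B)
    M◇-use  : T (sM L) → [ A ] ⊢ B → Use Γ (◇ A) (◇ B)
    K◇-use  : T (sKD L) → □[ S ]⊆ Γ → A ∷ S ⊢ B → Use Γ (◇ A) (◇ B)

  renameUse : Γ ⊆ Δ → Use Γ X C → Use Δ X C
  renameUse σ ⊥-use               = ⊥-use
  renameUse σ (∧-use e)           = ∧-use (rename (∷⁺ʳ _ (∷⁺ʳ _ σ)) e)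
  renameUse σ (∨-use e₁ e₂)       = ∨-use (rename (∷⁺ʳ _ σ) e₁) (rename (∷⁺ʳ _ σ) e₂)
  renameUse σ (⊃-use e₁ e₂)       = ⊃-use (rename σ e₁) (rename (∷⁺ʳ _ σ) e₂)
  renameUse σ (T□-use t e)        = T□-use t (rename (∷⁺ʳ _ σ) e)
  renameUse σ (M□-use t e)        = M□-use t e
  renameUse σ (D-use t e)         = D-use t e
  renameUse σ (C□-use t b e)      = C□-use t (All.map σ b) e
  renameUse σ (K□-use t b e)      = K□-use t (All.map σ b) e
  renameUse σ (CD-use t b e)      = CD-use t (All.map σ b) e
  renameUse σ (K◇□-use t m b e)   = K◇□-use t (σ m) (All.map σ b) e
  renameUse σ (M◇-use t e)        = M◇-use t e
  renameUse σ (K◇-use t b e)      = K◇-use t (All.map σ b) e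

  applyUse : X ∈ Γ → Use Γ X C → Γ ⊢ C
  applyUse m ⊥-use             = ⊥L m
  applyUse m (∧-use e)         = ∧L m e
  applyUse m (∨-use e₁ e₂)     = ∨L m e₁ e₂
  applyUse m (⊃-use e₁ e₂)     = ⊃L m e₁ e₂
  applyUse m (T□-use t e)      = T□L t m e
  applyUse m (M□-use t e)      = M□ t m e
  applyUse m (D-use t e)       = D t m e
  applyUse m (C□-use t b e)    = C□ t m b e
  applyUse m (K□-use t b e)    = K□ t (m ∷ b) e
  applyUse m (CD-use t b e)    = CD t (m ∷ b) e
  applyUse m (K◇□-use t q b e) = K◇ t q (m ∷ b) e
  applyUse m (M◇-use t e)      = M◇ t m e
  applyUse m (K◇-use t b e)    = K◇ t m b e

  -- Termination is by the cut formula, then the left and then the right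
  -- derivation: every principal reduction cuts on a proper subformula.
  mutual
    cut : Γ₁ ⊢ X → Δ ⊢ C → Γ₁ ⊆ Γ → Δ ⊆ X ∷ Γ → Γ ⊢ C
    cut d (ax m) σ ρ with ρ m
    ... | here refl = rename σ d
    ... | there m′  = ax m′
    cut d (⊥L m) σ ρ       = cutOrApply d σ (ρ m) ⊥-use
    cut d (∧L m e) σ ρ     =
      cutOrApply d σ (ρ m) (∧-use (cut d e (⊆-trans σ (⊆-trans there there)) (under (under ρ))))
    cut d (∧R e₁ e₂) σ ρ   = ∧R (cut d e₁ σ ρ) (cut d e₂ σ ρ)
    cut d (∨L m e₁ e₂) σ ρ =
      cutOrApply d σ (ρ m) (∨-use (cut d e₁ (⊆-trans σ there) (under ρ)) (cut d e₂ (⊆-trans σ there) (under ρ)))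
    cut d (∨R₁ e) σ ρ      = ∨R₁ (cut d e σ ρ)
    cut d (∨R₂ e) σ ρ      = ∨R₂ (cut d e σ ρ)
    cut d (⊃R e) σ ρ       = ⊃R (cut d e (⊆-trans σ there) (under ρ))
    cut d (⊃L m e₁ e₂) σ ρ =
      cutOrApply d σ (ρ m) (⊃-use (cut d e₁ σ ρ) (cut d e₂ (⊆-trans σ there) (under ρ)))
    cut d (T□L t m e) σ ρ  = cutOrApply d σ (ρ m) (T□-use t (cut d e (⊆-trans σ there) (under ρ)))
    cut d (M□ t m e) σ ρ   = cutOrApply d σ (ρ m) (M□-use t e)
    cut d (M◇ t m e) σ ρ   = cutOrApply d σ (ρ m) (M◇-use t e)
    cut d (D t m e) σ ρ    = cutOrApply d σ (ρ m) (D-use t e)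
    cut d (N□ t e) σ ρ     = N□ t e
    cut d (P◇ t e) σ ρ     = P◇ t e
    cut d (T◇ t e) σ ρ     = T◇ t (cut d e σ ρ)
    cut d (C□ t m b e) σ ρ with boxSplit (ρ m ∷ All.map ρ b)
    ... | withCut b′ inc       = cutUse d (C□-use t b′ (rename inc e)) σ
    ... | withoutCut (m′ ∷ b′) = C□ t m′ b′ e
    cut d (K□ t b e) σ ρ with boxSplit (All.map ρ b)
    ... | withCut b′ inc = cutUse d (K□-use t b′ (rename inc e)) σ
    ... | withoutCut b′  = K□ t b′ e
    cut d (CD t b e) σ ρ with boxSplit (All.map ρ b)
    ... | withCut b′ inc = cutUse d (CD-use t b′ (rename inc e)) σ
    ... | withoutCut b′  = CD t b′ e
    cut d (K◇ t m b e) σ ρ with ρ m | boxSplit (All.map ρ b)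
    ... | here refl | withoutCut b′  = cutUse d (K◇-use t b′ e) σ
    ... | there m′  | withCut b′ inc = cutUse d (K◇□-use t m′ b′ (rename (∷⁺ʳ _ inc) e)) σ
    ... | there m′  | withoutCut b′  = K◇ t m′ b′ e

    cutOrApply : Γ₁ ⊢ X → Γ₁ ⊆ Γ → A ∈ X ∷ Γ → Use Γ A C → Γ ⊢ C
    cutOrApply d σ (here refl) u = cutUse d u σ
    cutOrApply d σ (there m) u   = applyUse m u

    cutUse : Γ₁ ⊢ X → Use Γ X C → Γ₁ ⊆ Γ → Γ ⊢ C
    cutUse (ax m) u σ             = applyUse (σ m) u
    cutUse (⊥L m) u σ             = ⊥L (σ m)
    cutUse (∧L m d) u σ           = ∧L (σ m) (cutUse d (renameUse (⊆-trans there there) u) (∷⁺ʳ _ (∷⁺ʳ _ σ)))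
    cutUse (∨L m d₁ d₂) u σ       =
      ∨L (σ m) (cutUse d₁ (renameUse there u) (∷⁺ʳ _ σ)) (cutUse d₂ (renameUse there u) (∷⁺ʳ _ σ))
    cutUse (⊃L m d₁ d₂) u σ       = ⊃L (σ m) (rename σ d₁) (cutUse d₂ (renameUse there u) (∷⁺ʳ _ σ))
    cutUse (T□L t m d) u σ        = T□L t (σ m) (cutUse d (renameUse there u) (∷⁺ʳ _ σ))
    cutUse (∧R d₁ d₂) (∧-use e) σ = cut d₁ (cut d₂ e (⊆-trans σ there) swap⊆) σ ⊆-refl
    cutUse (∨R₁ d) (∨-use e₁ _) σ = cut d e₁ σ ⊆-refl
    cutUse (∨R₂ d) (∨-use _ e₂) σ = cut d e₂ σ ⊆-refl
    cutUse (⊃R d) (⊃-use e₁ e₂) σ = cut e₁ (cut d e₂ (∷⁺ʳ _ σ) (∷⁺ʳ _ there)) ⊆-refl ⊆-refl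
    cutUse (M□ t m d) u σ         = cut-M□ t (σ m) d u
    cutUse (N□ t d) u σ           = cut-N□ t d u
    cutUse (C□ t m b d) u σ       = cut-C□ t (σ m) (All.map σ b) d u
    cutUse (K□ t b d) u σ         = cut-K□ t (All.map σ b) d u
    cutUse (M◇ t m d) u σ         = cut-M◇ t (σ m) d u
    cutUse (K◇ t m b d) u σ       = cut-K◇ t (σ m) (All.map σ b) d u
    cutUse (P◇ t d) u σ           = cut-P◇ t d u
    cutUse (D t m d) u σ          = cut-D t (σ m) d u
    cutUse (CD t b d) u σ         = cut-CD t (All.map σ b) d u
    cutUse (T◇ t d) u σ           = cut-T◇ t d σ u

    cut-++ : S ⊢ A → A ∷ S′ ⊢ B → S ++ S′ ⊢ B
    cut-++ {S′ = S′} d e = cut d e (xs⊆xs++ys _ S′) (∷⁺ʳ _ (xs⊆ys++xs S′ _))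

    cut-++′ : S ⊢ A → P ∷ A ∷ S′ ⊢ B → P ∷ S ++ S′ ⊢ B
    cut-++′ {S′ = S′} d e = cut d e (⊆-trans (xs⊆xs++ys _ S′) there) (under (∷⁺ʳ _ (xs⊆ys++xs S′ _)))

    cut-M□ : T (sM L) → □ P ∈ Γ → [ P ] ⊢ A → Use Γ (□ A) C → Γ ⊢ C
    cut-M□ t m d (T□-use t′ e)      = cut (T□L t′ m (rename (xs⊆xs++ys _ _) d)) e ⊆-refl ⊆-refl
    cut-M□ t m d (M□-use _ e)       = M□ t m (cut-++ d e)
    cut-M□ t m d (D-use t′ e)       = D t′ m (cut-++ d e)
    cut-M□ t m d (C□-use t′ _ _)    = ⊥-elim (exclusive sM sC t t′)
    cut-M□ t m d (K□-use t′ _ _)    = ⊥-elim (exclusive sM sK t t′)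
    cut-M□ t m d (CD-use t′ _ _)    = ⊥-elim (exclusive sM sCD t t′)
    cut-M□ t m d (K◇□-use t′ _ _ _) = ⊥-elim (exclusive sM sKD t t′)

    cut-N□ : T (sN L) → [] ⊢ A → Use Γ (□ A) C → Γ ⊢ C
    cut-N□ t d (T□-use t′ e)      = cut d e (λ ()) ⊆-refl
    cut-N□ t d (M□-use _ e)       = N□ t (cut-++ d e)
    cut-N□ t d (D-use t′ e)       = P◇ (implies sD sP t′) (cut-++ d e)
    cut-N□ t d (C□-use t′ _ _)    = ⊥-elim (exclusive sN sC t t′)
    cut-N□ t d (K□-use t′ _ _)    = ⊥-elim (exclusive sN sK t t′)
    cut-N□ t d (CD-use t′ _ _)    = ⊥-elim (exclusive sN sCD t t′)
    cut-N□ t d (K◇□-use t′ _ _ _) = ⊥-elim (exclusive sN sKD t t′)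

    cut-C□ : T (sC L) → □ P ∈ Γ → □[ S ]⊆ Γ → P ∷ S ⊢ A → Use Γ (□ A) C → Γ ⊢ C
    cut-C□ t m b d (T□-use t′ e)       = cut (T□L* t′ (m ∷ b) (rename (xs⊆xs++ys _ _) d)) e ⊆-refl ⊆-refl
    cut-C□ t m b d (M□-use t′ _)       = ⊥-elim (exclusive sM sC t′ t)
    cut-C□ t m b d (D-use t′ _)        = ⊥-elim (exclusive sD sC t′ t)
    cut-C□ t m b d (C□-use _ b′ e)     = C□ t m (++⁺ b b′) (cut-++ d e)
    cut-C□ t m b d (K□-use t′ _ _)     = ⊥-elim (exclusive sC sK t t′)
    cut-C□ t m b d (CD-use t′ b′ e)    = CD t′ (m ∷ ++⁺ b b′) (cut-++ d e)
    cut-C□ t m b d (K◇□-use t′ q b′ e) = K◇ t′ q (m ∷ ++⁺ b b′) (cut-++′ d e)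

    cut-K□ : T (sK L) → □[ S ]⊆ Γ → S ⊢ A → Use Γ (□ A) C → Γ ⊢ C
    cut-K□ t b d (T□-use t′ e)       = cut (T□L* t′ b (rename (xs⊆xs++ys _ _) d)) e ⊆-refl ⊆-refl
    cut-K□ t b d (M□-use t′ _)       = ⊥-elim (exclusive sM sK t′ t)
    cut-K□ t b d (D-use t′ _)        = ⊥-elim (exclusive sD sK t′ t)
    cut-K□ t b d (C□-use t′ _ _)     = ⊥-elim (exclusive sC sK t′ t)
    cut-K□ t b d (K□-use _ b′ e)     = K□ t (++⁺ b b′) (cut-++ d e)
    cut-K□ t b d (CD-use t′ b′ e)    = CD t′ (++⁺ b b′) (cut-++ d e)
    cut-K□ t b d (K◇□-use t′ q b′ e) = K◇ t′ q (++⁺ b b′) (cut-++′ d e)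

    cut-M◇ : T (sM L) → ◇ P ∈ Γ → [ P ] ⊢ A → Use Γ (◇ A) C → Γ ⊢ C
    cut-M◇ t m d (M◇-use _ e)    = M◇ t m (cut-++ d e)
    cut-M◇ t m d (K◇-use t′ _ _) = ⊥-elim (exclusive sM sKD t t′)

    cut-K◇ : T (sKD L) → ◇ P ∈ Γ → □[ S ]⊆ Γ → P ∷ S ⊢ A → Use Γ (◇ A) C → Γ ⊢ C
    cut-K◇ t m b d (M◇-use t′ _)  = ⊥-elim (exclusive sM sKD t′ t)
    cut-K◇ t m b d (K◇-use _ b′ e) = K◇ t m (++⁺ b b′) (cut-++ d e)

    cut-P◇ : T (sP L) → [] ⊢ A → Use Γ (◇ A) C → Γ ⊢ C
    cut-P◇ t d (M◇-use _ e)    = P◇ t (cut-++ d e)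
    cut-P◇ t d (K◇-use t′ _ _) = ⊥-elim (exclusive sP sKD t t′)

    cut-D : T (sD L) → □ P ∈ Γ → [ P ] ⊢ A → Use Γ (◇ A) C → Γ ⊢ C
    cut-D t m d (M◇-use _ e)    = D t m (cut-++ d e)
    cut-D t m d (K◇-use t′ _ _) = ⊥-elim (exclusive sD sKD t t′)

    cut-CD : T (sCD L) → □[ S ]⊆ Γ → S ⊢ A → Use Γ (◇ A) C → Γ ⊢ C
    cut-CD t b d (M◇-use t′ _)   = ⊥-elim (exclusive sM sCD t′ t)
    cut-CD t b d (K◇-use _ b′ e) = CD t (++⁺ b b′) (cut-++ d e)

    cut-T◇ : T (sT L) → Γ₁ ⊢ A → Γ₁ ⊆ Γ → Use Γ (◇ A) C → Γ ⊢ C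
    cut-T◇ t d σ (M◇-use _ e) = T◇ t (cut d e σ (xs⊆xs++ys _ _))
    cut-T◇ {Γ = Γ} t d σ (K◇-use {S = S} _ b e) =
      T◇ t (T□L* t b (cut d e (⊆-trans σ (xs⊆ys++xs Γ S)) (∷⁺ʳ _ (xs⊆xs++ys S Γ))))

-- Structural rules of G1 and the embedding of G3

module Embedding (L : Logic) where

  contract∈ : ∀ {δ} → A ∈ Γ → G1 L (A ∷ Γ) δ → G1 L Γ δ
  contract∈ {A = A} m d with ∈-∃++ m
  ... | Γ₁ , Γ₂ , refl =
    perm (↭-sym (shift A Γ₁ Γ₂)) (LC (perm (↭-prep A (shift A Γ₁ Γ₂)) d))

  contractAll : ∀ {δ} Δ → Δ ⊆ Γ → G1 L (Δ ++ Γ) δ → G1 L Γ δ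
  contractAll []      inc d = d
  contractAll (A ∷ Δ) inc d =
    contractAll Δ (λ m → inc (there m)) (contract∈ (∈-++⁺ʳ Δ (inc #0)) d)

  weakenAll : ∀ {δ} Δ → G1 L Γ δ → G1 L (Δ ++ Γ) δ
  weakenAll []      d = d
  weakenAll (A ∷ Δ) d = LW (weakenAll Δ d)

  G1-⊆ : ∀ {δ} → Δ ⊆ Γ → G1 L Δ δ → G1 L Γ δ
  G1-⊆ {Δ = Δ} {Γ = Γ} inc d = contractAll Δ inc (perm (++-comm Γ Δ) (weakenAll Γ d))

  open G3 L

  singleton⊆ : A ∈ Γ → [ A ] ⊆ Γ
  singleton⊆ m (here refl) = m

  toG1 : Γ ⊢ C → G1 L Γ (just C)
  toG1 (ax m)         = G1-⊆ (singleton⊆ m) (idA _)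
  toG1 (⊥L m)         = G1-⊆ (singleton⊆ m) (RW botL)
  toG1 (∧L m d)       = contract∈ m (LC (L∧₂ (perm (↭-swap _ _ ↭-refl) (L∧₁ (toG1 d)))))
  toG1 (∧R d e)       = R∧ (toG1 d) (toG1 e)
  toG1 (∨L m d e)     = contract∈ m (L∨ (toG1 d) (toG1 e))
  toG1 (∨R₁ d)        = R∨₁ (toG1 d)
  toG1 (∨R₂ d)        = R∨₂ (toG1 d)
  toG1 (⊃R d)         = R⊃ (toG1 d)
  toG1 (⊃L m d e)     = contract∈ m (L⊃ (toG1 d) (toG1 e))
  toG1 (T□L t m d)    = contract∈ m (iT□ t (toG1 d))
  toG1 (M□ t m d)     = G1-⊆ (singleton⊆ m) (M□ t (toG1 d))
  toG1 (M◇ t m d)     = G1-⊆ (singleton⊆ m) (M◇ t (toG1 d))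
  toG1 (N□ t d)       = G1-⊆ (λ ()) (N□ t (toG1 d))
  toG1 (C□ t m b d)   = G1-⊆ (∈-∷⁺ʳ m (□⊆⇒map⊆ b)) (C□ t (toG1 d))
  toG1 (K□ t b d)     = G1-⊆ (□⊆⇒map⊆ b) (K□ t (toG1 d))
  toG1 (K◇ t m b d)   = G1-⊆ (∈-∷⁺ʳ m (□⊆⇒map⊆ b)) (K◇ t (toG1 d))
  toG1 (P◇ t d)       = G1-⊆ (λ ()) (P◇ t (toG1 d))
  toG1 (D t m d)      = G1-⊆ (singleton⊆ m) (Dr t (toG1 d))
  toG1 (CD t b d)     = G1-⊆ (□⊆⇒map⊆ b) (CDr t (toG1 d))
  toG1 (T◇ t d)       = T◇ t (toG1 d)

-- Soundness of G1 with respect to the Hilbert systems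

serial : Logic → Bool
serial L = hP L || (hN L && hD L)

module Hilbert (L : Logic) where

  infix  3 _⊩_
  infixl 5 _·_
  data _⊩_ (Γ : List Fm) : Fm → Set where
    hyp : A ∈ Γ → Γ ⊩ A
    thm : CX L A → Γ ⊩ A
    _·_ : Γ ⊩ A ⊃ B → Γ ⊩ A → Γ ⊩ B

  ⊃-refl : CX L (A ⊃ A)
  ⊃-refl {A = A} = mp (mp (ax7 A (A ⊃ A) A) (ax8 A (A ⊃ A))) (ax8 A A)

  rename⊩ : Γ ⊆ Δ → Γ ⊩ A → Δ ⊩ A
  rename⊩ σ (hyp m) = hyp (σ m)
  rename⊩ σ (thm c) = thm c
  rename⊩ σ (d · e) = rename⊩ σ d · rename⊩ σ e

  deduction : A ∷ Γ ⊩ B → Γ ⊩ A ⊃ B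
  deduction (hyp (here refl))             = thm ⊃-refl
  deduction {A = A} {B = B} (hyp (there m)) = thm (ax8 B A) · hyp m
  deduction {A = A} {B = B} (thm c)       = thm (ax8 B A) · thm c
  deduction {A = A} {B = B} (_·_ {A = P} d e) = thm (ax7 A P B) · deduction d · deduction e

  closed : [] ⊩ A → CX L A
  closed (thm c) = c
  closed (d · e) = mp (closed d) (closed e)

  substitute : A ∷ Γ ⊩ B → Γ ⊩ A → Γ ⊩ B
  substitute d a = deduction d · a

  ∧-intro : Γ ⊩ A → Γ ⊩ B → Γ ⊩ A ∧ B
  ∧-intro {A = A} {B = B} a b =
    thm (ax5 ⊤f A B) · (thm (ax8 A ⊤f) · a) · (thm (ax8 B ⊤f) · b) · thm ⊃-refl

  ∧-uncurry : A ∷ B ∷ Γ ⊩ C → A ∧ B ∷ Γ ⊩ C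
  ∧-uncurry {A = A} {B = B} d =
    rename⊩ there (deduction (deduction d)) · (thm (ax2 A B) · hyp #0) · (thm (ax1 A B) · hyp #0)

  □-context : T (hC L) → A ∷ S ⊩ B → □ A ∷ map □_ S ⊩ □ B
  □-context {S = []} h d = thm (monB (closed (deduction d))) · hyp #0
  □-context {A = A} {S = P ∷ S} h d =
    substitute (rename⊩ (∷⁺ʳ _ (⊆-trans there there)) (□-context h (∧-uncurry d)))
               (thm (axCB h A P) · ∧-intro (hyp #0) (hyp #1))

  necessitation : T (hN L) → CX L A → CX L (□ A)
  necessitation {A = A} h c = mp (monB (mp (ax8 A ⊤f) c)) (axNB h)

  ◇⊤ : T (serial L) → CX L (◇ ⊤f)
  ◇⊤ h with T-∨⁻ h
  ... | inj₁ p = axPD p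
  ... | inj₂ nd with Equivalence.to T-∧ nd
  ...   | n , d = mp (axD d ⊤f) (axNB n)

  possibility : T (serial L) → CX L A → CX L (◇ A)
  possibility {A = A} h c = mp (monD (mp (ax8 A ⊤f) c)) (◇⊤ h)

  sound : ∀ {δ} → G1 L Γ δ → Γ ⊩ fromMaybe ⊥f δ
  sound (perm π d)               = rename⊩ (⊆-reflexive-↭ π) (sound d)
  sound (idA A)                  = hyp #0
  sound botL                     = hyp #0
  sound (L∧₁ {A = A} {B = B} d)      = substitute (rename⊩ (∷⁺ʳ _ there) (sound d)) (thm (ax1 A B) · hyp #0)
  sound (L∧₂ {A = A} {B = B} d)      = substitute (rename⊩ (∷⁺ʳ _ there) (sound d)) (thm (ax2 A B) · hyp #0)
  sound (R∧ d e)                 = ∧-intro (sound d) (sound e)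
  sound (L∨ {A = A} {B = B} d e)     =
    thm (ax6 A B _) · rename⊩ there (deduction (sound d)) · rename⊩ there (deduction (sound e)) · hyp #0
  sound (R∨₁ {A = A} {B = B} d)      = thm (ax3 A B) · sound d
  sound (R∨₂ {A = A} {B = B} d)      = thm (ax4 A B) · sound d
  sound (R⊃ d)                   = deduction (sound d)
  sound (L⊃ d e)                 = substitute (rename⊩ (∷⁺ʳ _ there) (sound e)) (hyp #0 · rename⊩ there (sound d))
  sound (LW d)                   = rename⊩ there (sound d)
  sound (RW {A = A} d)           = thm (efq A) · sound d
  sound (LC d)                   = rename⊩ (∈-∷⁺ʳ #0 ⊆-refl) (sound d)
  sound (M□ t d)                 = thm (monB (closed (deduction (sound d)))) · hyp #0
  sound (M◇ t d)                 = thm (monD (closed (deduction (sound d)))) · hyp #0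
  sound (N□ t d)                 = thm (necessitation (implies sN hN t) (closed (sound d)))
  sound (C□ t d)                 = □-context (implies sC hC t) (sound d)
  sound (K□ t {[]} d)            = thm (necessitation (implies sK hN t) (closed (sound d)))
  sound (K□ t {_ ∷ _} d)         = □-context (implies sK hC t) (sound d)
  sound (K◇ t {[]} d)            = thm (monD (closed (deduction (sound d)))) · hyp #0
  sound (K◇ t {_ ∷ _} {A} {B} d) =
    thm (axKD (implies sKD hC t) A B) · rename⊩ there (□-context (implies sKD hC t) (deduction (sound d))) · hyp #0
  sound (P◇ t d)                 = thm (possibility (implies sP serial t) (closed (sound d)))
  sound (Dr t {B = B} d)         = thm (axD (implies sD hD t) B) · (thm (monB (closed (deduction (sound d)))) · hyp #0)
  sound (CDr t {[]} d)           = thm (possibility (implies sCD serial t) (closed (sound d)))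
  sound (CDr t {_ ∷ _} {A} d)    = thm (axD (implies sCD hD t) A) · □-context (implies sCD hC t) (sound d)
  sound (iT□ t {A = A} d)        = substitute (rename⊩ (∷⁺ʳ _ there) (sound d)) (thm (axTB (implies sT hT t) A) · hyp #0)
  sound (T◇ t {A = A} d)         = thm (axTD (implies sT hT t) A) · sound d

-- Completeness of G3 with respect to the Hilbert systems

module Completeness (L : Logic) where

  open G3 L

  □-mono : [ A ] ⊢ B → [ □ A ] ⊢ □ B
  □-mono d with T-∨⁻ (decideForAll (λ L′ → T? (sM L′ || sC L′ || sK L′)) L)
  ... | inj₁ t = M□ t #0 d
  ... | inj₂ t with T-∨⁻ t
  ...   | inj₁ t′ = C□ t′ #0 [] d
  ...   | inj₂ t′ = K□ t′ (#0 ∷ []) d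

  ◇-mono : [ A ] ⊢ B → [ ◇ A ] ⊢ ◇ B
  ◇-mono d with T-∨⁻ (decideForAll (λ L′ → T? (sM L′ || sKD L′)) L)
  ... | inj₁ t = M◇ t #0 d
  ... | inj₂ t = K◇ t #0 [] d

  ⊤-intro : [] ⊢ ⊤f
  ⊤-intro = ⊃R (⊥L #0)

  ⊃-inv : [] ⊢ A ⊃ B → [ A ] ⊢ B
  ⊃-inv d = cut d (⊃L #0 (ax #1) (ax #0)) (λ ()) ⊆-refl

  complete : CX L A → [] ⊢ A
  complete (ax1 A B)   = ⊃R (∧L #0 (ax #0))
  complete (ax2 A B)   = ⊃R (∧L #0 (ax #1))
  complete (ax3 A B)   = ⊃R (∨R₁ (ax #0))
  complete (ax4 A B)   = ⊃R (∨R₂ (ax #0))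
  complete (ax5 A B C) = ⊃R (⊃R (⊃R (∧R (⊃L #2 (ax #0) (ax #0)) (⊃L #1 (ax #0) (ax #0)))))
  complete (ax6 A B C) = ⊃R (⊃R (⊃R (∨L #0 (⊃L #3 (ax #0) (ax #0)) (⊃L #2 (ax #0) (ax #0)))))
  complete (ax7 A B C) = ⊃R (⊃R (⊃R (⊃L #2 (ax #0) (⊃L #0 (⊃L #2 (ax #1) (ax #0)) (ax #0)))))
  complete (ax8 A B)   = ⊃R (⊃R (ax #1))
  complete (efq A)     = ⊃R (⊥L #0)
  complete (mp d e)    = cut (complete d) (⊃L #0 (rename (λ ()) (complete e)) (ax #0)) ⊆-refl ⊆-refl
  complete (monB d)    = ⊃R (□-mono (⊃-inv (complete d)))
  complete (monD d)    = ⊃R (◇-mono (⊃-inv (complete d)))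
  complete (axPD h) with T-∨⁻ (implies hP (λ L′ → sP L′ || sCD L′) h)
  ... | inj₁ t = P◇ t ⊤-intro
  ... | inj₂ t = CD t [] ⊤-intro
  complete (axNB h) with T-∨⁻ (implies hN (λ L′ → sN L′ || sK L′) h)
  ... | inj₁ t = N□ t ⊤-intro
  ... | inj₂ t = K□ t [] ⊤-intro
  complete (axCB h A B) with T-∨⁻ (implies hC (λ L′ → sC L′ || sK L′) h)
  ... | inj₁ t = ⊃R (∧L #0 (C□ t #0 (#1 ∷ []) (∧R (ax #0) (ax #1))))
  ... | inj₂ t = ⊃R (∧L #0 (K□ t (#0 ∷ #1 ∷ []) (∧R (ax #0) (ax #1))))
  complete (axKD h A B) = ⊃R (⊃R (K◇ (implies hC sKD h) #0 (#1 ∷ []) (⊃L #1 (ax #0) (ax #0))))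
  complete (axD h A) with T-∨⁻ (implies hD (λ L′ → sD L′ || sCD L′) h)
  ... | inj₁ t = ⊃R (D t #0 (ax #0))
  ... | inj₂ t = ⊃R (CD t (#0 ∷ []) (ax #0))
  complete (axTB h A)   = ⊃R (T□L (implies hT sT h) #0 (ax #0))
  complete (axTD h A)   = ⊃R (T◇ (implies hT sT h) (ax #0))

mainTheorem20 : (L : Logic) (A : Fm) → G1 L [] (just A) ⇔ CX L A
mainTheorem20 L A = mk⇔ (λ d → closed (sound d)) (λ c → toG1 (complete c))
  where
  open Hilbert L using (closed; sound)
  open Embedding L using (toG1)
  open Completeness L using (complete)
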